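{- Let $D$ be a finite directed graph with minimum out-degree at least $\delta$. Then $D$ has a sink set of size at most $\frac{|V(D)|}{\delta+1}$.
   Context: For a vertex $v$ of a directed graph $D$, the source set of $v$ is $\mathcal{W}(v)=\{u\in V(D):\text{there is a directed path from }u\text{ to }v\}$ (including $v$ itself via the trivial path). A set $\mathcal{S}\subseteq V(D)$ is a sink set if $V(D)=\bigcup_{v\in\mathcal{S}}\mathcal{W}(v)$. -}

module Defs where

open import Data.Nat using (ℕ)
open import Data.Bool using (Bool; true; false)
open import Data.Fin using (Fin)
open import Data.Fin.Subset using (Subset; _∈_)
open import Data.Vec using (tabulate)
open import Data.Fin.Subset using (∣_∣)
open import Data.Product using (∃-syntax; _×_)
open import Relation.Binary.PropositionalEquality using (_≡_)
open import Relation.Binary.Construct.Closure.ReflexiveTransitive using (Star)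
open import Relation.Nullary using (¬_)
open import Data.Bool using (T)

record Digraph (n : ℕ) : Set where
  field
    adj      : Fin n → Fin n → Bool
    loopless : ∀ v → adj v v ≡ false

open Digraph public

Arc : ∀ {n} → Digraph n → Fin n → Fin n → Set
Arc D u v = T (adj D u v)

outDeg : ∀ {n} → Digraph n → Fin n → ℕ
outDeg D v = ∣ tabulate (λ w → adj D v w) ∣

InSourceSet : ∀ {n} → Digraph n → Fin n → Fin n → Set
InSourceSet D v u = Star (Arc D) u v

IsSinkSet : ∀ {n} → Digraph n → Subset n → Set
IsSinkSet {n} D S = ∀ (u : Fin n) → ∃[ v ] (v ∈ S × InSourceSet D v u)

{-# OPTIONS --safe #-}

-- Every vertex reaches a terminal strong component (one that no arc leaves), so one
-- vertex from each terminal component forms a sink set; we take the least-index one,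
-- which is decidable because reachability is (saturate {u} under arcs). A terminal
-- component contains the closed out-neighbourhood of each of its vertices, of size at
-- least δ + 1, and distinct components are disjoint, so there are at most n / (δ + 1).

module Submission where

open import Defs
open import Data.Nat using (ℕ; suc; _≤_; _*_)
open import Data.Fin using (Fin)
open import Data.Fin.Subset using (Subset; ∣_∣)
open import Data.Product using (∃-syntax; _×_)

open import Level using (Level)
open import Data.Bool using (Bool; T)
open import Data.Bool.Properties using (T-≡)
open import Data.Empty using (⊥-elim)
open import Data.Nat using (zero; _+_; _<_; z≤n; s≤s)
open import Data.Nat.Properties
  using (≤-trans; ≤-reflexive; +-suc; +-mono-≤; ≮⇒≥; <⇒≱; m≤n⇒m<n∨m≡n; module ≤-Reasoning)
open import Data.Nat.Induction using (<-wellFounded)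
open import Data.Nat.GeneralisedArithmetic using (fold)
open import Data.Fin as Fin using (toℕ)
open import Data.Fin.Properties using (any?; _<?_; suc-injective) renaming (≤-antisym to ≤ᶠ-antisym)
open import Data.Fin.Subset as Subset
  using (_∈_; _∉_; _⊆_; _⊂_; _∪_; ⁅_⁆; inside; outside)
open import Data.Fin.Subset.Properties
  using (_∈?_; _⊂?_; ∣p∣≤n; ∉⊥; x∈⁅x⁆; x∈⁅y⁆⇒x≡y; ∣⁅x⁆∣≡1; ⊆-antisym; p⊆q⇒∣p∣≤∣q∣; p⊂q⇒∣p∣<∣q∣;
         p⊆p∪q; x∈p∪q⁻; x∈p∪q⁺)
open import Data.Product using (_,_; proj₁; proj₂)
open import Data.Product.Relation.Binary.Lex.Strict using (×-Lex; ×-wellFounded)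
open import Data.Sum using (_⊎_; inj₁; inj₂)
open import Data.Vec using (_∷_; []; tabulate; here; there)
open import Data.Vec.Properties using (lookup∘tabulate; []=⇒lookup; lookup⇒[]=)
open import Function using (_on_; _∘_; Equivalence)
open import Induction.WellFounded using (WellFounded; Acc; acc)
open import Relation.Binary using (Rel; Decidable)
import Relation.Binary.Construct.On as On
open import Relation.Binary.PropositionalEquality using (_≡_; refl; sym; trans; cong; subst)
open import Relation.Binary.Construct.Closure.ReflexiveTransitive using (Star; ε; _◅_; _◅◅_)
open import Relation.Nullary using (¬_; yes; no; contradiction)
open import Relation.Nullary.Decidable
  using (⌊_⌋; map′; T?; toWitness; fromWitness; decidable-stable; _×-dec_; _⊎-dec_; ¬?)
open import Relation.Unary using (Pred) renaming (Decidable to Decidableᵘ)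

private
  variable
    ℓ : Level
    m n k : ℕ
    u v w x : Fin n
    p q : Subset n

∈-tabulate⁻ : (f : Fin n → Bool) → x ∈ tabulate f → T (f x)
∈-tabulate⁻ {x = x} f x∈ =
  Equivalence.from T-≡ (trans (sym (lookup∘tabulate f x)) ([]=⇒lookup x∈))

∈-tabulate⁺ : (f : Fin n → Bool) → T (f x) → x ∈ tabulate f
∈-tabulate⁺ {x = x} f fx =
  lookup⇒[]= x (tabulate f) (trans (lookup∘tabulate f x) (Equivalence.to T-≡ fx))

⟦_⟧ : {P : Pred (Fin n) ℓ} → Decidableᵘ P → Subset n
⟦ P? ⟧ = tabulate (λ x → ⌊ P? x ⌋)

module _ {P : Pred (Fin n) ℓ} (P? : Decidableᵘ P) where

  ∈⟦⟧⁺ : P x → x ∈ ⟦ P? ⟧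
  ∈⟦⟧⁺ {x = x} px = ∈-tabulate⁺ _ (fromWitness {a? = P? x} px)

  ∈⟦⟧⁻ : x ∈ ⟦ P? ⟧ → P x
  ∈⟦⟧⁻ x∈ = toWitness (∈-tabulate⁻ _ x∈)

Disjoint : Subset n → Subset n → Set
Disjoint p q = ∀ {x} → x ∈ p → x ∉ q

Disjoint-tail : ∀ {s t} → Disjoint (s ∷ p) (t ∷ q) → Disjoint p q
Disjoint-tail disj x∈p x∈q = disj (there x∈p) (there x∈q)

∣p∪q∣≡∣p∣+∣q∣ : (p q : Subset n) → Disjoint p q → ∣ p ∪ q ∣ ≡ ∣ p ∣ + ∣ q ∣
∣p∪q∣≡∣p∣+∣q∣ []            []            _    = refl
∣p∪q∣≡∣p∣+∣q∣ (inside ∷ p)  (inside ∷ q)  disj = ⊥-elim (disj here here)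
∣p∪q∣≡∣p∣+∣q∣ (inside ∷ p)  (outside ∷ q) disj =
  cong suc (∣p∪q∣≡∣p∣+∣q∣ p q (Disjoint-tail disj))
∣p∪q∣≡∣p∣+∣q∣ (outside ∷ p) (inside ∷ q)  disj =
  trans (cong suc (∣p∪q∣≡∣p∣+∣q∣ p q (Disjoint-tail disj))) (sym (+-suc ∣ p ∣ ∣ q ∣))
∣p∪q∣≡∣p∣+∣q∣ (outside ∷ p) (outside ∷ q) disj = ∣p∪q∣≡∣p∣+∣q∣ p q (Disjoint-tail disj)

⋃[_] : Subset m → (Fin m → Subset n) → Subset n
⋃[ [] ]          F = Subset.⊥
⋃[ inside ∷ S ]  F = F Fin.zero ∪ ⋃[ S ] (F ∘ Fin.suc)
⋃[ outside ∷ S ] F = ⋃[ S ] (F ∘ Fin.suc)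

∈-⋃⁻ : (S : Subset m) (F : Fin m → Subset n) → x ∈ ⋃[ S ] F → ∃[ i ] (i ∈ S × x ∈ F i)
∈-⋃⁻ []            F x∈ = ⊥-elim (∉⊥ x∈)
∈-⋃⁻ (inside ∷ S)  F x∈ with x∈p∪q⁻ (F Fin.zero) (⋃[ S ] (F ∘ Fin.suc)) x∈
... | inj₁ x∈F₀ = Fin.zero , here , x∈F₀
... | inj₂ x∈⋃  with ∈-⋃⁻ S (F ∘ Fin.suc) x∈⋃
...   | i , i∈S , x∈Fi = Fin.suc i , there i∈S , x∈Fi
∈-⋃⁻ (outside ∷ S) F x∈ with ∈-⋃⁻ S (F ∘ Fin.suc) x∈
... | i , i∈S , x∈Fi = Fin.suc i , there i∈S , x∈Fi

PairwiseDisjoint : Subset m → (Fin m → Subset n) → Set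
PairwiseDisjoint S F = ∀ {i j x} → i ∈ S → j ∈ S → x ∈ F i → x ∈ F j → i ≡ j

PairwiseDisjoint-tail : ∀ {s} {S : Subset m} {F : Fin (suc m) → Subset n} →
                        PairwiseDisjoint (s ∷ S) F → PairwiseDisjoint S (F ∘ Fin.suc)
PairwiseDisjoint-tail disj i∈S j∈S x∈Fi x∈Fj =
  suc-injective (disj (there i∈S) (there j∈S) x∈Fi x∈Fj)

∣S∣*k≤∣⋃[S]F∣ : (S : Subset m) (F : Fin m → Subset n) →
                (∀ {i} → i ∈ S → k ≤ ∣ F i ∣) → PairwiseDisjoint S F →
                ∣ S ∣ * k ≤ ∣ ⋃[ S ] F ∣
∣S∣*k≤∣⋃[S]F∣ []            F large disj = z≤n
∣S∣*k≤∣⋃[S]F∣ (outside ∷ S) F large disj =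
  ∣S∣*k≤∣⋃[S]F∣ S (F ∘ Fin.suc) (large ∘ there) (PairwiseDisjoint-tail disj)
∣S∣*k≤∣⋃[S]F∣ {k = k} (inside ∷ S) F large disj = begin
  k + ∣ S ∣ * k                             ≤⟨ +-mono-≤ (large here) tail-bound ⟩
  ∣ F Fin.zero ∣ + ∣ ⋃[ S ] (F ∘ Fin.suc) ∣ ≡⟨ ∣p∪q∣≡∣p∣+∣q∣ _ _ head-disjoint ⟨
  ∣ ⋃[ inside ∷ S ] F ∣                     ∎
  where
  open ≤-Reasoning
  tail-bound : ∣ S ∣ * k ≤ ∣ ⋃[ S ] (F ∘ Fin.suc) ∣
  tail-bound = ∣S∣*k≤∣⋃[S]F∣ S (F ∘ Fin.suc) (large ∘ there) (PairwiseDisjoint-tail disj)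
  head-disjoint : Disjoint (F Fin.zero) (⋃[ S ] (F ∘ Fin.suc))
  head-disjoint x∈F₀ x∈⋃ with ∈-⋃⁻ S (F ∘ Fin.suc) x∈⋃
  ... | i , i∈S , x∈Fi with disj here (there i∈S) x∈F₀ x∈Fi
  ...   | ()

module Closure (f : Subset n → Subset n) (inflationary : ∀ p → p ⊆ f p) where

  Closed : Subset n → Set
  Closed p = f p ⊆ p

  ⊆-fold : ∀ k → p ⊆ fold p f k
  ⊆-fold zero    x∈p = x∈p
  ⊆-fold (suc k) x∈p = inflationary _ (⊆-fold k x∈p)

  Closed-f : Closed p → Closed (f p)
  Closed-f {p = p} closed = subst Closed (sym (⊆-antisym closed (inflationary p))) closed

  ¬⊂⇒Closed : ¬ (p ⊂ f p) → Closed p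
  ¬⊂⇒Closed {p = p} p⊄fp {x} x∈fp =
    decidable-stable (x ∈? p) (λ x∉p → p⊄fp (inflationary p , x , x∈fp , x∉p))

  closed-or-grows : ∀ p k → Closed (fold p f k) ⊎ k ≤ ∣ fold p f k ∣
  closed-or-grows p zero = inj₂ z≤n
  closed-or-grows p (suc k) with closed-or-grows p k | fold p f k ⊂? f (fold p f k)
  ... | inj₁ closed | _         = inj₁ (Closed-f closed)
  ... | inj₂ large  | yes grows = inj₂ (≤-trans (s≤s large) (p⊂q⇒∣p∣<∣q∣ grows))
  ... | inj₂ _      | no ¬grows = inj₁ (Closed-f (¬⊂⇒Closed ¬grows))

  closure : Subset n → Subset n
  closure p = fold p f (suc n)

  closure-closed : ∀ p → Closed (closure p)
  closure-closed p with closed-or-grows p (suc n)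
  ... | inj₁ closed = closed
  ... | inj₂ large  = contradiction (∣p∣≤n (closure p)) (<⇒≱ large)

module Reachability {R : Rel (Fin n) ℓ} (R? : Decidable R) where

  successor? : (p : Subset n) → Decidableᵘ (λ w → ∃[ v ] (v ∈ p × R v w))
  successor? p w = any? (λ v → v ∈? p ×-dec R? v w)

  step : Subset n → Subset n
  step p = p ∪ ⟦ successor? p ⟧

  open Closure step (λ p → p⊆p∪q ⟦ successor? p ⟧)

  reach : Fin n → Subset n
  reach u = closure ⁅ u ⁆

  step-sound : (∀ {x} → x ∈ p → Star R u x) → x ∈ step p → Star R u x
  step-sound {p = p} sound x∈ with x∈p∪q⁻ p ⟦ successor? p ⟧ x∈
  ... | inj₁ x∈p  = sound x∈p
  ... | inj₂ x∈sp with ∈⟦⟧⁻ (successor? p) x∈sp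
  ...   | v , v∈p , Rvx = sound v∈p ◅◅ (Rvx ◅ ε)

  fold-sound : ∀ k → x ∈ fold ⁅ u ⁆ step k → Star R u x
  fold-sound zero    x∈ rewrite x∈⁅y⁆⇒x≡y _ x∈ = ε
  fold-sound (suc k) x∈ = step-sound (fold-sound k) x∈

  reach-sound : x ∈ reach u → Star R u x
  reach-sound = fold-sound (suc n)

  reach-closed : v ∈ reach u → R v w → w ∈ reach u
  reach-closed {v = v} {u = u} v∈ Rvw =
    closure-closed ⁅ u ⁆ (x∈p∪q⁺ (inj₂ (∈⟦⟧⁺ (successor? (reach u)) (v , v∈ , Rvw))))

  reach-complete : Star R u x → x ∈ reach u
  reach-complete {u = u} = follow (⊆-fold (suc n) (x∈⁅x⁆ u))
    where
    follow : v ∈ reach u → Star R v x → x ∈ reach u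
    follow v∈ ε         = v∈
    follow v∈ (Rvw ◅ s) = follow (reach-closed v∈ Rvw) s

  star? : Decidable (Star R)
  star? u x = map′ reach-sound reach-complete (x ∈? reach u)

  reach-mono : Star R u w → reach w ⊆ reach u
  reach-mono uw x∈ = reach-complete (uw ◅◅ reach-sound x∈)

  Representative : Fin n → Set ℓ
  Representative v = ∀ w → Star R v w → Star R w v × v Fin.≤ w

  Escape : Fin n → Fin n → Set ℓ
  Escape v w = Star R v w × (¬ Star R w v ⊎ w Fin.< v)

  representative-or-escape : ∀ v → Representative v ⊎ ∃[ w ] Escape v w
  representative-or-escape v with any? (λ w → star? v w ×-dec (¬? (star? w v) ⊎-dec w <? v))
  ... | yes escape = inj₂ escape
  ... | no ¬escape = inj₁ λ w vw →
    decidable-stable (star? w v) (λ ¬wv → ¬escape (w , vw , inj₁ ¬wv)) ,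
    ≮⇒≥ (λ w<v → ¬escape (w , vw , inj₂ w<v))

  representative? : Decidableᵘ Representative
  representative? v with representative-or-escape v
  ... | inj₁ rep                 = yes rep
  ... | inj₂ (w , vw , inj₁ ¬wv) = no λ rep → ¬wv (proj₁ (rep w vw))
  ... | inj₂ (w , vw , inj₂ w<v) = no λ rep → <⇒≱ w<v (proj₂ (rep w vw))

  representatives-unique : ∀ {i j} → Representative i → Representative j →
                           Star R i x → Star R j x → i ≡ j
  representatives-unique {x = x} {i} {j} rep-i rep-j ix jx = ≤ᶠ-antisym
    (proj₂ (rep-i j (ix ◅◅ proj₁ (rep-j x jx))))
    (proj₂ (rep-j i (jx ◅◅ proj₁ (rep-i x ix))))

  _⊏_ : Rel (Fin n) _
  _⊏_ = ×-Lex _≡_ _<_ _<_ on (λ v → ∣ reach v ∣ , toℕ v)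

  ⊏-wellFounded : WellFounded _⊏_
  ⊏-wellFounded = On.wellFounded _ (×-wellFounded <-wellFounded <-wellFounded)

  escape⇒⊏ : Escape v w → w ⊏ v
  escape⇒⊏ {v = v} (vw , inj₁ ¬wv) =
    inj₁ (p⊂q⇒∣p∣<∣q∣ (reach-mono vw , v , reach-complete ε , ¬wv ∘ reach-sound))
  escape⇒⊏ (vw , inj₂ w<v) with m≤n⇒m<n∨m≡n (p⊆q⇒∣p∣≤∣q∣ (reach-mono vw))
  ... | inj₁ smaller = inj₁ smaller
  ... | inj₂ same    = inj₂ (same , w<v)

  reaches-representative : ∀ u → ∃[ r ] (Star R u r × Representative r)
  reaches-representative u = descend (⊏-wellFounded u)
    where
    descend : Acc _⊏_ v → ∃[ r ] (Star R v r × Representative r)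
    descend {v = v} (acc smaller) with representative-or-escape v
    ... | inj₁ rep = v , ε , rep
    ... | inj₂ (w , escape) with descend (smaller (escape⇒⊏ escape))
    ...   | r , wr , rep = r , proj₁ escape ◅◅ wr , rep

N⁺[_]_ : Digraph n → Fin n → Subset n
N⁺[ D ] v = ⁅ v ⁆ ∪ tabulate (adj D v)

∣N⁺[D]v∣≡1+outDeg : (D : Digraph n) (v : Fin n) → ∣ N⁺[ D ] v ∣ ≡ suc (outDeg D v)
∣N⁺[D]v∣≡1+outDeg D v =
  trans (∣p∪q∣≡∣p∣+∣q∣ ⁅ v ⁆ _ v∉out) (cong (_+ outDeg D v) (∣⁅x⁆∣≡1 v))
  where
  v∉out : Disjoint ⁅ v ⁆ (tabulate (adj D v))
  v∉out x∈⁅v⁆ x∈out rewrite x∈⁅y⁆⇒x≡y v x∈⁅v⁆ =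
    subst T (loopless D v) (∈-tabulate⁻ (adj D v) x∈out)

∈N⁺⇒Star : (D : Digraph n) → x ∈ N⁺[ D ] v → Star (Arc D) v x
∈N⁺⇒Star {v = v} D x∈ with x∈p∪q⁻ ⁅ v ⁆ (tabulate (adj D v)) x∈
... | inj₁ x∈⁅v⁆ rewrite x∈⁅y⁆⇒x≡y v x∈⁅v⁆ = ε
... | inj₂ x∈out = ∈-tabulate⁻ (adj D v) x∈out ◅ ε

lemma4p7 : ∀ (n δ : ℕ) (D : Digraph n) →
    (∀ (v : Fin n) → δ ≤ outDeg D v) →
    ∃[ S ] (IsSinkSet D S × ∣ S ∣ * suc δ ≤ n)
lemma4p7 n δ D mindeg =
  S , sink , ≤-trans (∣S∣*k≤∣⋃[S]F∣ S (N⁺[ D ]_) large disjoint) (∣p∣≤n (⋃[ S ] (N⁺[ D ]_)))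
  where
  open Reachability (λ u v → T? (adj D u v))

  S : Subset n
  S = ⟦ representative? ⟧

  sink : IsSinkSet D S
  sink u with reaches-representative u
  ... | r , ur , rep = r , ∈⟦⟧⁺ representative? rep , ur

  large : ∀ {v} → v ∈ S → suc δ ≤ ∣ N⁺[ D ] v ∣
  large {v} _ = ≤-trans (s≤s (mindeg v)) (≤-reflexive (sym (∣N⁺[D]v∣≡1+outDeg D v)))

  disjoint : PairwiseDisjoint S (N⁺[ D ]_)
  disjoint i∈S j∈S x∈N⁺i x∈N⁺j =
    representatives-unique (∈⟦⟧⁻ representative? i∈S) (∈⟦⟧⁻ representative? j∈S)
      (∈N⁺⇒Star D x∈N⁺i) (∈N⁺⇒Star D x∈N⁺j)
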